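{- For every $k\ge0$, $\sum_{(\lambda,A)\in\mathrm{HD}_k}\mathrm{wt}_q(\lambda,A)=1$, where $\mathrm{HD}_k$ is the set of half $\delta_k^+$-configurations defined below.
   Context: Partitions are identified with Ferrers diagrams (English convention); $\delta_k=(k,k-1,\dots,1)$; for $\lambda\subset\mu$, $\mu/\lambda$ is the set of cells of $\mu$ not in $\lambda$. A half $\delta_k^+$-configuration is a pair $(\lambda,A)$ with $\lambda$ a partition, $\lambda\subset\delta_{k-1}$, and $A$ a set of (horizontal) arrows, each occupying all cells of one whole row of $\delta_k/\lambda$ (at most one arrow per row), such that no outer corner of $\delta_k/\lambda$ is occupied by an arrow; an outer corner is a cell $c\in\delta_k/\lambda$ with $\lambda\cup\{c\}$ a partition. The length of an arrow is the number of cells it occupies and $\|A\|$ is the sum of arrow lengths. The $q$-weight is $\mathrm{wt}_q(\lambda,A)=(-1)^{|A|}q^{|\lambda|+\|A\|}$. -}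

module Defs where

open import Data.Nat using (ℕ; zero; suc; _+_; _∸_; _<ᵇ_; _≤ᵇ_; _≡ᵇ_)
open import Data.Bool using (Bool; true; false; _∧_; _∨_; not; if_then_else_)
open import Data.Vec using (Vec; []; _∷_)
open import Data.List using (List; []; _∷_; map; concatMap; cartesianProduct; foldr; upTo; filterᵇ)
open import Data.Product using (_×_; _,_)
open import Algebra.Bundles using (CommutativeRing)

-- Conventions: cells are (i , j) with 0-indexed row i and column j.
-- δ_k = { (i , j) | i + j < k }.
-- A partition λ contained in δ_{k-1} has at most k rows; it is stored as
-- its vector of row lengths (λ_0 , … , λ_{k-1}) (padded with zeros);
-- rows beyond the vector have length 0.

row : ∀ {k} → Vec ℕ k → ℕ → ℕ
row []       _       = 0
row (x ∷ _)  zero    = x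
row (_ ∷ xs) (suc i) = row xs i

-- the arrow set A is stored as a Boolean vector: rowB A i = true iff row i carries an arrow
rowB : ∀ {k} → Vec Bool k → ℕ → Bool
rowB []       _       = false
rowB (x ∷ _)  zero    = x
rowB (_ ∷ xs) (suc i) = rowB xs i

allBelow : ℕ → (ℕ → Bool) → Bool
allBelow zero    P = true
allBelow (suc n) P = allBelow n P ∧ P n

anyBelow : ℕ → (ℕ → Bool) → Bool
anyBelow zero    P = false
anyBelow (suc n) P = anyBelow n P ∨ P n

sumBelow : ℕ → (ℕ → ℕ) → ℕ
sumBelow zero    f = 0
sumBelow (suc n) f = sumBelow n f + f n

countBelow : ℕ → (ℕ → Bool) → ℕ
countBelow n P = sumBelow n (λ i → if P i then 1 else 0)

inDelta : ℕ → ℕ → ℕ → Bool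
inDelta k i j = (i + j) <ᵇ k

inPart : ∀ {k} → Vec ℕ k → ℕ → ℕ → Bool
inPart lam i j = j <ᵇ row lam i

isPartition : ∀ {k} → Vec ℕ k → Bool
isPartition {k} lam = allBelow k (λ i → row lam (suc i) ≤ᵇ row lam i)

insideDelta : ∀ {k} → ℕ → Vec ℕ k → Bool
insideDelta {k} m lam = allBelow k (λ i → allBelow (row lam i) (λ j → inDelta m i j))

inSkew : ∀ {k} → ℕ → Vec ℕ k → ℕ → ℕ → Bool
inSkew k lam i j = inDelta k i j ∧ not (inPart lam i j)

-- outer corner of δ_k / lam: a cell c of δ_k / lam such that lam ∪ {c} is a partition,
-- i.e. c = (i , lam_i) and (i = 0 or lam_{i-1} > lam_i)
isOuterCorner : ∀ {k} → ℕ → Vec ℕ k → ℕ → ℕ → Bool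
isOuterCorner k lam i j =
  inSkew k lam i j ∧ (j ≡ᵇ row lam i) ∧ ((i ≡ᵇ 0) ∨ (j <ᵇ row lam (i ∸ 1)))

-- an arrow in row i occupies all cells of row i of δ_k / lam (columns j < k suffice)
arrowLength : ∀ {k} → ℕ → Vec ℕ k → ℕ → ℕ
arrowLength k lam i = countBelow k (λ j → inSkew k lam i j)

arrowOK : ∀ {k} → ℕ → Vec ℕ k → ℕ → Bool
arrowOK k lam i =
  anyBelow k (λ j → inSkew k lam i j)
  ∧ allBelow k (λ j → not (inSkew k lam i j ∧ isOuterCorner k lam i j))

isHalfConfig : (k : ℕ) → Vec ℕ k → Vec Bool k → Bool
isHalfConfig k lam A =
  isPartition lam ∧ insideDelta (k ∸ 1) lam
  ∧ allBelow k (λ i → not (rowB A i) ∨ arrowOK k lam i)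

vecsUpTo : (n b : ℕ) → List (Vec ℕ n)
vecsUpTo zero    b = [] ∷ []
vecsUpTo (suc n) b = concatMap (λ x → map (x ∷_) (vecsUpTo n b)) (upTo (suc b))

boolVecs : (n : ℕ) → List (Vec Bool n)
boolVecs zero    = [] ∷ []
boolVecs (suc n) = concatMap (λ x → map (x ∷_) (boolVecs n)) (true ∷ false ∷ [])

-- HD_k, listed without repetition (every lam ⊂ δ_{k-1} has entries ≤ k)
HD : (k : ℕ) → List (Vec ℕ k × Vec Bool k)
HD k = filterᵇ (λ { (lam , A) → isHalfConfig k lam A })
               (cartesianProduct (vecsUpTo k k) (boolVecs k))

sizePart : ∀ {k} → Vec ℕ k → ℕ
sizePart {k} lam = sumBelow k (row lam)

numArrows : ∀ {k} → Vec Bool k → ℕ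
numArrows {k} A = countBelow k (rowB A)

totalArrowLength : (k : ℕ) → Vec ℕ k → Vec Bool k → ℕ
totalArrowLength k lam A = sumBelow k (λ i → if rowB A i then arrowLength k lam i else 0)

module _ {c ℓ} (R : CommutativeRing c ℓ) where
  open CommutativeRing R renaming (_+_ to _+R_; _*_ to _*R_)

  pow : Carrier → ℕ → Carrier
  pow x zero    = 1#
  pow x (suc n) = x *R pow x n

  sumR : List Carrier → Carrier
  sumR = foldr _+R_ 0#

  wt : Carrier → (k : ℕ) → Vec ℕ k × Vec Bool k → Carrier
  wt q k (lam , A) = pow (- 1#) (numArrows A) *R pow q (sizePart lam + totalArrowLength k lam A)

module Submission where

-- Let λ ⊂ δ_{k-1}. Row i of δ_k/λ is the nonempty segment of columns λ_i … k-1-i,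
-- of length k - i - λ_i, and its only candidate outer corner is its first cell
-- (i , λ_i), which is an outer corner iff i = 0 or λ_{i-1} > λ_i. So an arrow may
-- occupy row i iff i ≥ 1 and λ_{i-1} = λ_i, and summing over the arrow sets first
-- factorizes the weight:
--     Σ wt = Σ_λ q^{|λ|} Π_{i ≥ 1, λ_{i-1} = λ_i} (1 - q^{k-i-λ_i}).
-- The sum over λ is then computed row by row. Put P(p , n) = Π_{p ≤ r < n} (1 - q^{r+1}).
-- The rows below a row of length p, when n rows are left, contribute exactly P(p , n)
-- (rowRecursion); the induction step is the telescoping identity
-- Σ_{x ≤ m} q^x P(x , n) = P(m , n), which for the first row gives P(n , n) = 1.

open import Defs
open import Data.Nat using (ℕ; zero; suc; _+_; _∸_; _<ᵇ_; _≤ᵇ_; _≡ᵇ_; _≤_; _<_; _⊓_; z≤n; s≤s)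
import Data.Nat.Properties as ℕP
open import Data.Bool using (Bool; true; false; _∧_; _∨_; not; if_then_else_; T)
open import Data.Bool.Properties using (∧-assoc; ∧-identityʳ; ∧-zeroʳ; ∨-zeroʳ; not-¬; T-≡)
open import Data.Empty using (⊥-elim)
open import Data.Sum using (inj₁; inj₂)
open import Data.Vec using (Vec; []; _∷_)
open import Data.List using (List; []; _∷_; map; concatMap; cartesianProduct; upTo; filterᵇ; _++_; [_])
open import Data.List.Properties using (map-++; map-∘; map-cong; upTo-∷ʳ)
open import Data.Product using (_×_; _,_)
open import Function using (_∘_; id; const)
open import Function.Bundles using (Equivalence)
open import Relation.Binary.PropositionalEquality using (_≡_; _≢_; refl; sym; trans; cong; cong₂; module ≡-Reasoning)
open import Algebra.Bundles using (CommutativeRing)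

T⇒≡true : ∀ {b} → T b → b ≡ true
T⇒≡true = Equivalence.to T-≡

≡true⇒T : ∀ {b} → b ≡ true → T b
≡true⇒T = Equivalence.from T-≡

<ᵇ-complete : ∀ {m n} → m < n → (m <ᵇ n) ≡ true
<ᵇ-complete = T⇒≡true ∘ ℕP.<⇒<ᵇ

≤ᵇ-complete : ∀ {m n} → m ≤ n → (m ≤ᵇ n) ≡ true
≤ᵇ-complete = T⇒≡true ∘ ℕP.≤⇒≤ᵇ

<ᵇ-sound : ∀ {m n} → (m <ᵇ n) ≡ true → m < n
<ᵇ-sound {m} {n} = ℕP.<ᵇ⇒< m n ∘ ≡true⇒T

≤ᵇ-sound : ∀ {m n} → (m ≤ᵇ n) ≡ true → m ≤ n
≤ᵇ-sound {m} {n} = ℕP.≤ᵇ⇒≤ m n ∘ ≡true⇒T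

<ᵇ-false : ∀ {m n} → n ≤ m → (m <ᵇ n) ≡ false
<ᵇ-false {m} {n} n≤m with m <ᵇ n in e
... | true  = ⊥-elim (ℕP.<⇒≱ (<ᵇ-sound e) n≤m)
... | false = refl

<ᵇ-irrefl : ∀ m → (m <ᵇ m) ≡ false
<ᵇ-irrefl m = <ᵇ-false {m} {m} ℕP.≤-refl

≡ᵇ-refl : ∀ m → (m ≡ᵇ m) ≡ true
≡ᵇ-refl m = T⇒≡true (ℕP.≡⇒≡ᵇ m m refl)

≡ᵇ-false : ∀ {m n} → m ≢ n → (m ≡ᵇ n) ≡ false
≡ᵇ-false {m} {n} m≢n with m ≡ᵇ n in e
... | true  = ⊥-elim (m≢n (ℕP.≡ᵇ⇒≡ m n (≡true⇒T e)))
... | false = refl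

allBelow-suc : ∀ n (P : ℕ → Bool) → allBelow (suc n) P ≡ (P 0 ∧ allBelow n (P ∘ suc))
allBelow-suc zero    P = sym (∧-identityʳ (P 0))
allBelow-suc (suc n) P = trans (cong (_∧ P (suc n)) (allBelow-suc n P)) (∧-assoc (P 0) _ _)

sumBelow-suc : ∀ n (f : ℕ → ℕ) → sumBelow (suc n) f ≡ f 0 + sumBelow n (f ∘ suc)
sumBelow-suc zero    f = sym (ℕP.+-identityʳ (f 0))
sumBelow-suc (suc n) f = trans (cong (_+ f (suc n)) (sumBelow-suc n f)) (ℕP.+-assoc (f 0) _ _)

allBelow-cong : ∀ n {P Q : ℕ → Bool} → (∀ i → P i ≡ Q i) → allBelow n P ≡ allBelow n Q
allBelow-cong zero    P≡Q = refl
allBelow-cong (suc n) P≡Q = cong₂ _∧_ (allBelow-cong n P≡Q) (P≡Q n)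

sumBelow-cong : ∀ n {f g : ℕ → ℕ} → (∀ i → f i ≡ g i) → sumBelow n f ≡ sumBelow n g
sumBelow-cong zero    f≡g = refl
sumBelow-cong (suc n) f≡g = cong₂ _+_ (sumBelow-cong n f≡g) (f≡g n)

sumBelow-zero : ∀ n → sumBelow n (const 0) ≡ 0
sumBelow-zero zero    = refl
sumBelow-zero (suc n) = trans (ℕP.+-identityʳ _) (sumBelow-zero n)

anyBelow-witness : ∀ n (P : ℕ → Bool) a → a < n → P a ≡ true → anyBelow n P ≡ true
anyBelow-witness (suc n) P a a<1+n Pa with ℕP.m<1+n⇒m<n∨m≡n a<1+n
... | inj₁ a<n  = cong (_∨ P n) (anyBelow-witness n P a a<n Pa)
... | inj₂ refl = trans (cong (anyBelow a P ∨_) Pa) (∨-zeroʳ _)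

allBelow-true : ∀ n (P : ℕ → Bool) → (∀ j → j < n → P j ≡ true) → allBelow n P ≡ true
allBelow-true zero    P all = refl
allBelow-true (suc n) P all =
  cong₂ _∧_ (allBelow-true n P (λ j j<n → all j (ℕP.m<n⇒m<1+n j<n))) (all n (ℕP.n<1+n n))

allBelow-single : ∀ n (P : ℕ → Bool) a → a < n → (∀ j → j ≢ a → P j ≡ true) → allBelow n P ≡ P a
allBelow-single (suc n) P a a<1+n others with ℕP.m<1+n⇒m<n∨m≡n a<1+n
... | inj₁ a<n  = trans (cong₂ _∧_ (allBelow-single n P a a<n others) (others n (λ n≡a → ℕP.<-irrefl (sym n≡a) a<n)))
                        (∧-identityʳ _)
... | inj₂ refl = cong (_∧ P a) (allBelow-true a P (λ j j<a → others j (ℕP.<⇒≢ j<a)))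

countBelow-initial : ∀ N k → k ≤ N → countBelow N (λ j → j <ᵇ k) ≡ k
countBelow-initial N       zero    _         = sumBelow-zero N
countBelow-initial (suc N) (suc k) (s≤s k≤N) = trans (sumBelow-suc N _) (cong suc (countBelow-initial N k k≤N))

countBelow-row : ∀ N i a k → k ∸ i ≤ N → i + a ≤ k →
  countBelow N (λ j → inDelta k i j ∧ not (j <ᵇ a)) ≡ k ∸ (i + a)
countBelow-row N zero zero k k≤N _ =
  trans (sumBelow-cong N (λ j → cong (λ b → if b then 1 else 0) (∧-identityʳ (j <ᵇ k))))
        (countBelow-initial N k k≤N)
countBelow-row N (suc i) zero (suc k) k∸i≤N (s≤s i≤k) = countBelow-row N i zero k k∸i≤N i≤k
countBelow-row zero i (suc a) k k∸i≤0 i+1+a≤k = ⊥-elim (ℕP.n≮0 (ℕP.<-≤-trans 0<k∸i k∸i≤0))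
  where
  0<k∸i : 0 < k ∸ i
  0<k∸i = ℕP.m<n⇒0<n∸m (ℕP.<-≤-trans (ℕP.m<m+n i (s≤s z≤n)) i+1+a≤k)
countBelow-row (suc N) i (suc a) k k∸i≤1+N i+1+a≤k = begin
  countBelow (suc N) cell                                     ≡⟨ sumBelow-suc N _ ⟩
  (if cell 0 then 1 else 0) + countBelow N (cell ∘ suc)       ≡⟨ cong (_+ countBelow N (cell ∘ suc)) first-cell-outside ⟩
  countBelow N (cell ∘ suc)                                   ≡⟨ sumBelow-cong N (λ j → cong (λ m → if (m <ᵇ k) ∧ not (j <ᵇ a) then 1 else 0) (ℕP.+-suc i j)) ⟩
  countBelow N (λ j → inDelta k (suc i) j ∧ not (j <ᵇ a))     ≡⟨ countBelow-row N (suc i) a k k∸1+i≤N (ℕP.≤-trans (ℕP.≤-reflexive (sym (ℕP.+-suc i a))) i+1+a≤k) ⟩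
  k ∸ (suc i + a)                                             ≡⟨ cong (k ∸_) (sym (ℕP.+-suc i a)) ⟩
  k ∸ (i + suc a)                                             ∎
  where
  open ≡-Reasoning
  cell : ℕ → Bool
  cell j = inDelta k i j ∧ not (j <ᵇ suc a)
  first-cell-outside : (if cell 0 then 1 else 0) ≡ 0
  first-cell-outside with inDelta k i 0
  ... | true  = refl
  ... | false = refl
  k∸1+i≤N : k ∸ suc i ≤ N
  k∸1+i≤N = ℕP.≤-trans (ℕP.≤-reflexive (sym (ℕP.pred[m∸n]≡m∸[1+n] k i))) (ℕP.pred-mono-≤ k∸i≤1+N)

rowInside-eval : ∀ m o n x → m ≡ o + n → allBelow x (λ j → inDelta m o j) ≡ (x ≤ᵇ n)
rowInside-eval m o n x refl = trans (allBelow-cong x (λ j → shift o j)) (allLess x)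
  where
  shift : ∀ o j → ((o + j) <ᵇ (o + n)) ≡ (j <ᵇ n)
  shift zero    j = refl
  shift (suc o) j = shift o j
  allLess : ∀ x → allBelow x (λ j → j <ᵇ n) ≡ (x ≤ᵇ n)
  allLess zero    = refl
  allLess (suc x) = trans (cong (_∧ (x <ᵇ n)) (allLess x)) (≤-absorbs-< x)
    where
    ≤-absorbs-< : ∀ x → ((x ≤ᵇ n) ∧ (x <ᵇ n)) ≡ (x <ᵇ n)
    ≤-absorbs-< x with x <ᵇ n in e
    ... | true  = trans (∧-identityʳ _) (≤ᵇ-complete (ℕP.<⇒≤ (<ᵇ-sound {x} {n} e)))
    ... | false = ∧-zeroʳ _

-- arrowOK k λ i and arrowLength k λ i see λ only through a = λ_i and p = λ_{i-1}:
-- these are the same tests with a and p as parameters.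
arrowOKAt : ℕ → ℕ → ℕ → ℕ → Bool
arrowOKAt k i a p = anyBelow k cell ∧ allBelow k (λ j → not (cell j ∧ (cell j ∧ (j ≡ᵇ a) ∧ ((i ≡ᵇ 0) ∨ (j <ᵇ p)))))
  where
  cell : ℕ → Bool
  cell j = inDelta k i j ∧ not (j <ᵇ a)

arrowLengthAt : ℕ → ℕ → ℕ → ℕ
arrowLengthAt k i a = countBelow k (λ j → inDelta k i j ∧ not (j <ᵇ a))

-- When row i of δ_k/λ starts at column a < k - i, an arrow may be placed in it
-- exactly when its first cell (i , a) is not an outer corner: i ≠ 0 and a ≥ p.
arrowOKAt-eval : ∀ k i a p → i + a < k → arrowOKAt k i a p ≡ not ((i ≡ᵇ 0) ∨ (a <ᵇ p))
arrowOKAt-eval k i a p i+a<k = cong₂ _∧_ nonempty (trans only-first-cell first-cell-test)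
  where
  cell : ℕ → Bool
  cell j = inDelta k i j ∧ not (j <ᵇ a)
  cornerFree : ℕ → Bool
  cornerFree j = not (cell j ∧ (cell j ∧ (j ≡ᵇ a) ∧ ((i ≡ᵇ 0) ∨ (j <ᵇ p))))
  a<k : a < k
  a<k = ℕP.≤-<-trans (ℕP.m≤n+m a i) i+a<k
  first-cell : cell a ≡ true
  first-cell = cong₂ (λ u v → u ∧ not v) (<ᵇ-complete i+a<k) (<ᵇ-irrefl a)
  nonempty : anyBelow k cell ≡ true
  nonempty = anyBelow-witness k cell a a<k first-cell
  other-cell : ∀ j → j ≢ a → cornerFree j ≡ true
  other-cell j j≢a rewrite ≡ᵇ-false j≢a with cell j
  ... | true  = refl
  ... | false = refl
  only-first-cell : allBelow k cornerFree ≡ cornerFree a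
  only-first-cell = allBelow-single k cornerFree a a<k other-cell
  first-cell-test : cornerFree a ≡ not ((i ≡ᵇ 0) ∨ (a <ᵇ p))
  first-cell-test rewrite first-cell | ≡ᵇ-refl a = refl

arrowLengthAt-eval : ∀ k i a → i + a ≤ k → arrowLengthAt k i a ≡ k ∸ (i + a)
arrowLengthAt-eval k i a = countBelow-row k i a k (ℕP.m∸n≤m k i)

insideFrom : ∀ {n} → ℕ → ℕ → Vec ℕ n → Bool
insideFrom {n} m o v = allBelow n (λ i → allBelow (row v i) (λ j → inDelta m (o + i) j))

insideFrom-cons : ∀ n m o x (v : Vec ℕ n) →
  insideFrom m o (x ∷ v) ≡ (allBelow x (λ j → inDelta m o j) ∧ insideFrom m (suc o) v)
insideFrom-cons n m o x v = trans (allBelow-suc n _)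
  (cong₂ _∧_ (allBelow-cong x (λ j → cong (λ r → inDelta m r j) (ℕP.+-identityʳ o)))
             (allBelow-cong n (λ i → allBelow-cong (row v i) (λ j → cong (λ r → inDelta m r j) (ℕP.+-suc o i)))))

isPartition-cons : ∀ n x (v : Vec ℕ n) → isPartition (x ∷ v) ≡ ((row v 0 ≤ᵇ x) ∧ isPartition v)
isPartition-cons n x v = allBelow-suc n _

∧-interchange : ∀ a b c d → (a ∧ b) ∧ (c ∧ d) ≡ (c ∧ a) ∧ (b ∧ d)
∧-interchange true  b     true  d = refl
∧-interchange true  true  false d = refl
∧-interchange true  false false d = refl
∧-interchange false b     true  d = refl
∧-interchange false b     false d = refl

if-∧ : ∀ {a} {A : Set a} b₁ b₂ b₃ (x y : A) →
  (if b₁ ∧ (b₂ ∧ b₃) then x else y) ≡ (if b₁ ∧ b₂ then (if b₃ then x else y) else y)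
if-∧ true  true  b₃ x y = refl
if-∧ true  false b₃ x y = refl
if-∧ false b₂    b₃ x y = refl

module RingSums {c ℓ} (R : CommutativeRing c ℓ) where
  open CommutativeRing R renaming (_+_ to _+R_; _*_ to _*R_; refl to ≈-refl; sym to ≈-sym; trans to ≈-trans)
  open import Relation.Binary.Reasoning.Setoid setoid
  open import Algebra.Properties.Ring ring using (-0#≈0#; -‿+-comm)

  if-cong : ∀ b {x y : Carrier} → (b ≡ true → x ≈ y) → (if b then x else 0#) ≈ (if b then y else 0#)
  if-cong true  x≈y = x≈y refl
  if-cong false _   = ≈-refl

  sum-++ : ∀ xs ys → sumR R (xs ++ ys) ≈ sumR R xs +R sumR R ys
  sum-++ []       ys = ≈-sym (+-identityˡ _)
  sum-++ (x ∷ xs) ys = ≈-trans (+-congˡ (sum-++ xs ys)) (≈-sym (+-assoc _ _ _))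

  module _ {a} {A : Set a} where
    sum-cong : ∀ (xs : List A) {f g : A → Carrier} → (∀ x → f x ≈ g x) → sumR R (map f xs) ≈ sumR R (map g xs)
    sum-cong []       f≈g = ≈-refl
    sum-cong (x ∷ xs) f≈g = +-cong (f≈g x) (sum-cong xs f≈g)

    sum-neg : ∀ (xs : List A) (f : A → Carrier) → sumR R (map (λ x → - f x) xs) ≈ - sumR R (map f xs)
    sum-neg []       f = ≈-sym -0#≈0#
    sum-neg (x ∷ xs) f = ≈-trans (+-congˡ (sum-neg xs f)) (-‿+-comm _ _)

    sum-scale : ∀ (xs : List A) a (f : A → Carrier) → sumR R (map (λ x → a *R f x) xs) ≈ a *R sumR R (map f xs)
    sum-scale []       a f = ≈-sym (zeroʳ a)
    sum-scale (x ∷ xs) a f = ≈-trans (+-congˡ (sum-scale xs a f)) (≈-sym (distribˡ a _ _))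

    sum-if : ∀ (xs : List A) b (f : A → Carrier) →
      sumR R (map (λ x → if b then f x else 0#) xs) ≈ (if b then sumR R (map f xs) else 0#)
    sum-if xs       true  f = ≈-refl
    sum-if []       false f = ≈-refl
    sum-if (x ∷ xs) false f = ≈-trans (+-identityˡ _) (sum-if xs false f)

    sum-filter : ∀ (xs : List A) (P : A → Bool) (f : A → Carrier) →
      sumR R (map f (filterᵇ P xs)) ≈ sumR R (map (λ x → if P x then f x else 0#) xs)
    sum-filter []       P f = ≈-refl
    sum-filter (x ∷ xs) P f with P x
    ... | true  = +-congˡ (sum-filter xs P f)
    ... | false = ≈-trans (sum-filter xs P f) (≈-sym (+-identityˡ _))

    sum-map : ∀ {b} {B : Set b} (g : B → A) (f : A → Carrier) (ys : List B) →
      sumR R (map f (map g ys)) ≈ sumR R (map (f ∘ g) ys)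
    sum-map g f ys = reflexive (cong (sumR R) (sym (map-∘ ys)))

    sum-concatMap : ∀ {b} {B : Set b} (g : B → List A) (f : A → Carrier) (ys : List B) →
      sumR R (map f (concatMap g ys)) ≈ sumR R (map (λ y → sumR R (map f (g y))) ys)
    sum-concatMap g f []       = ≈-refl
    sum-concatMap g f (y ∷ ys) = begin
      sumR R (map f (g y ++ concatMap g ys))              ≡⟨ cong (sumR R) (map-++ f (g y) (concatMap g ys)) ⟩
      sumR R (map f (g y) ++ map f (concatMap g ys))      ≈⟨ sum-++ (map f (g y)) (map f (concatMap g ys)) ⟩
      sumR R (map f (g y)) +R sumR R (map f (concatMap g ys)) ≈⟨ +-congˡ (sum-concatMap g f ys) ⟩
      sumR R (map (λ y → sumR R (map f (g y))) (y ∷ ys))  ∎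

  sum-cart : ∀ {a b} {A : Set a} {B : Set b} (xs : List A) (ys : List B) (f : A × B → Carrier) →
    sumR R (map f (cartesianProduct xs ys)) ≈ sumR R (map (λ x → sumR R (map (λ y → f (x , y)) ys)) xs)
  sum-cart []       ys f = ≈-refl
  sum-cart (x ∷ xs) ys f = begin
    sumR R (map f (map (x ,_) ys ++ cartesianProduct xs ys))
      ≡⟨ cong (sumR R) (map-++ f (map (x ,_) ys) (cartesianProduct xs ys)) ⟩
    sumR R (map f (map (x ,_) ys) ++ map f (cartesianProduct xs ys))
      ≈⟨ sum-++ (map f (map (x ,_) ys)) (map f (cartesianProduct xs ys)) ⟩
    sumR R (map f (map (x ,_) ys)) +R sumR R (map f (cartesianProduct xs ys))
      ≈⟨ +-cong (sum-map (x ,_) f ys) (sum-cart xs ys f) ⟩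
    sumR R (map (λ x → sumR R (map (λ y → f (x , y)) ys)) (x ∷ xs)) ∎

  sumTo : ℕ → (ℕ → Carrier) → Carrier
  sumTo zero    g = 0#
  sumTo (suc n) g = sumTo n g +R g n

  sum-upTo : ∀ n (f : ℕ → Carrier) → sumR R (map f (upTo n)) ≈ sumTo n f
  sum-upTo zero    f = ≈-refl
  sum-upTo (suc n) f = begin
    sumR R (map f (upTo (suc n)))      ≡⟨ cong (sumR R ∘ map f) (sym (upTo-∷ʳ n)) ⟩
    sumR R (map f (upTo n ++ [ n ]))   ≡⟨ cong (sumR R) (map-++ f (upTo n) [ n ]) ⟩
    sumR R (map f (upTo n) ++ [ f n ]) ≈⟨ sum-++ (map f (upTo n)) [ f n ] ⟩
    sumR R (map f (upTo n)) +R (f n +R 0#) ≈⟨ +-cong (sum-upTo n f) (+-identityʳ _) ⟩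
    sumTo n f +R f n                   ∎

  sumTo-cong : ∀ N {f g : ℕ → Carrier} → (∀ x → x < N → f x ≈ g x) → sumTo N f ≈ sumTo N g
  sumTo-cong zero    f≈g = ≈-refl
  sumTo-cong (suc N) f≈g = +-cong (sumTo-cong N (λ x x<N → f≈g x (ℕP.m<n⇒m<1+n x<N))) (f≈g N (ℕP.n<1+n N))

  sumTo-upto : ∀ N m (g : ℕ → Carrier) → sumTo N (λ x → if x ≤ᵇ m then g x else 0#) ≈ sumTo (N ⊓ suc m) g
  sumTo-upto zero    m g = ≈-refl
  sumTo-upto (suc N) m g with N ≤ᵇ m in e
  ... | true  = begin
    sumTo N (λ x → if x ≤ᵇ m then g x else 0#) +R g N ≈⟨ +-congʳ (sumTo-upto N m g) ⟩
    sumTo (N ⊓ suc m) g +R g N  ≡⟨ cong (λ M → sumTo M g +R g N) (ℕP.m≤n⇒m⊓n≡m (ℕP.m≤n⇒m≤1+n N≤m)) ⟩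
    sumTo (suc N) g             ≡⟨ cong (λ M → sumTo M g) (sym (ℕP.m≤n⇒m⊓n≡m (s≤s N≤m))) ⟩
    sumTo (suc N ⊓ suc m) g     ∎
    where
    N≤m : N ≤ m
    N≤m = ≤ᵇ-sound e
  ... | false = begin
    sumTo N (λ x → if x ≤ᵇ m then g x else 0#) +R 0# ≈⟨ +-identityʳ _ ⟩
    sumTo N (λ x → if x ≤ᵇ m then g x else 0#)       ≈⟨ sumTo-upto N m g ⟩
    sumTo (N ⊓ suc m) g        ≡⟨ cong (λ M → sumTo M g) (trans (ℕP.m≥n⇒m⊓n≡n m<N) (sym (ℕP.m≥n⇒m⊓n≡n (ℕP.m≤n⇒m≤1+n m<N)))) ⟩
    sumTo (suc N ⊓ suc m) g    ∎
    where
    m<N : suc m ≤ N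
    m<N = ℕP.≰⇒> (λ N≤m → not-¬ e (≤ᵇ-complete N≤m))

module Weights {c ℓ} (R : CommutativeRing c ℓ) (q : CommutativeRing.Carrier R) where
  open CommutativeRing R renaming (_+_ to _+R_; _*_ to _*R_; refl to ≈-refl; sym to ≈-sym; trans to ≈-trans)
  open import Relation.Binary.Reasoning.Setoid setoid
  open import Algebra.Properties.Ring ring using (-1*x≈-x; -0#≈0#; -‿distribˡ-*; -‿distribʳ-*)
  open import Algebra.Properties.CommutativeSemigroup *-commutativeSemigroup using (interchange; x∙yz≈y∙xz)
  open RingSums R

  pw : ℕ → Carrier
  pw = pow R q

  pw-+ : ∀ m n → pw (m + n) ≈ pw m *R pw n
  pw-+ zero    n = ≈-sym (*-identityˡ _)
  pw-+ (suc m) n = ≈-trans (*-congˡ (pw-+ m n)) (≈-sym (*-assoc _ _ _))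

  one-minus : ∀ a b P → - ((a *R b) *R P) +R a *R P ≈ a *R ((1# +R - b) *R P)
  one-minus a b P = begin
    - ((a *R b) *R P) +R a *R P    ≈⟨ +-comm _ _ ⟩
    a *R P +R - ((a *R b) *R P)    ≈⟨ +-congˡ (-‿cong (*-assoc a b P)) ⟩
    a *R P +R - (a *R (b *R P))    ≈⟨ +-congˡ (-‿distribʳ-* a (b *R P)) ⟩
    a *R P +R a *R - (b *R P)      ≈⟨ ≈-sym (distribˡ a P (- (b *R P))) ⟩
    a *R (P +R - (b *R P))         ≈⟨ *-congˡ (+-cong (≈-sym (*-identityˡ P)) (-‿distribˡ-* b P)) ⟩
    a *R (1# *R P +R (- b) *R P)   ≈⟨ *-congˡ (≈-sym (distribʳ P 1# (- b))) ⟩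
    a *R ((1# +R - b) *R P)        ∎

  rowFactor : Bool → ℕ → Carrier
  rowFactor b l = if b then 1# +R - pw l else 1#

  arrowProduct : ℕ → (ℕ → Bool) → (ℕ → ℕ) → Carrier
  arrowProduct zero    ok L = 1#
  arrowProduct (suc n) ok L = rowFactor (ok 0) (L 0) *R arrowProduct n (ok ∘ suc) (L ∘ suc)

  signedTerm : Bool → ℕ → ℕ → Carrier
  signedTerm admissible c s = if admissible then pow R (- 1#) c *R pw s else 0#

  signedTerm-suc : ∀ a c s → signedTerm a (suc c) s ≈ - signedTerm a c s
  signedTerm-suc false c s = ≈-sym -0#≈0#
  signedTerm-suc true  c s = ≈-trans (*-assoc _ _ _) (-1*x≈-x _)

  arrowTerm : (n : ℕ) → (ℕ → Bool) → (ℕ → ℕ) → ℕ → Vec Bool n → Carrier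
  arrowTerm n ok L e A = signedTerm (allBelow n (λ i → not (rowB A i) ∨ ok i))
                                    (countBelow n (rowB A))
                                    (e + sumBelow n (λ i → if rowB A i then L i else 0))

  arrowTerm-cons : ∀ n ok L e b (A : Vec Bool n) → arrowTerm (suc n) ok L e (b ∷ A) ≡
    signedTerm ((not b ∨ ok 0) ∧ allBelow n (λ i → not (rowB A i) ∨ ok (suc i)))
               ((if b then 1 else 0) + countBelow n (rowB A))
               (e + ((if b then L 0 else 0) + sumBelow n (λ i → if rowB A i then L (suc i) else 0)))
  arrowTerm-cons n ok L e b A =
    trans (cong (λ a → signedTerm a count length) (allBelow-suc n admissible))
          (cong₂ (signedTerm admissible′) (sumBelow-suc n (λ i → if rowB (b ∷ A) i then 1 else 0))
                                          (cong (e +_) (sumBelow-suc n (λ i → if rowB (b ∷ A) i then L i else 0))))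
    where
    admissible : ℕ → Bool
    admissible i = not (rowB (b ∷ A) i) ∨ ok i
    admissible′ : Bool
    admissible′ = admissible 0 ∧ allBelow n (admissible ∘ suc)
    count length : ℕ
    count  = countBelow (suc n) (rowB (b ∷ A))
    length = e + sumBelow (suc n) (λ i → if rowB (b ∷ A) i then L i else 0)

  arrowTerm-false : ∀ n ok L e (A : Vec Bool n) → arrowTerm (suc n) ok L e (false ∷ A) ≡ arrowTerm n (ok ∘ suc) (L ∘ suc) e A
  arrowTerm-false n ok L e = arrowTerm-cons n ok L e false

  arrowTerm-true : ∀ n ok L e (A : Vec Bool n) →
    arrowTerm (suc n) ok L e (true ∷ A) ≈ (if ok 0 then - arrowTerm n (ok ∘ suc) (L ∘ suc) (e + L 0) A else 0#)
  arrowTerm-true n ok L e A rewrite arrowTerm-cons n ok L e true A with ok 0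
  ... | false = ≈-refl
  ... | true  = ≈-trans (signedTerm-suc admissible count (e + (L 0 + length)))
                        (-‿cong (reflexive (cong (signedTerm admissible count) (sym (ℕP.+-assoc e (L 0) length)))))
    where
    admissible : Bool
    admissible = allBelow n (λ i → not (rowB A i) ∨ ok (suc i))
    count length : ℕ
    count      = countBelow n (rowB A)
    length     = sumBelow n (λ i → if rowB A i then L (suc i) else 0)

  sum-boolVecs-suc : ∀ n (f : Vec Bool (suc n) → Carrier) → sumR R (map f (boolVecs (suc n))) ≈
    sumR R (map (λ A → f (true ∷ A)) (boolVecs n)) +R sumR R (map (λ A → f (false ∷ A)) (boolVecs n))
  sum-boolVecs-suc n f =
    ≈-trans (sum-concatMap (λ b → map (b ∷_) (boolVecs n)) f (true ∷ false ∷ []))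
            (+-cong (sum-map (true ∷_) f (boolVecs n)) (≈-trans (+-identityʳ _) (sum-map (false ∷_) f (boolVecs n))))

  arrowSum : ∀ n ok L e → sumR R (map (arrowTerm n ok L e) (boolVecs n)) ≈ pw e *R arrowProduct n ok L
  arrowSum zero ok L e = begin
    (1# *R pw (e + 0)) +R 0# ≈⟨ ≈-trans (+-identityʳ _) (*-identityˡ _) ⟩
    pw (e + 0)               ≡⟨ cong pw (ℕP.+-identityʳ e) ⟩
    pw e                     ≈⟨ ≈-sym (*-identityʳ _) ⟩
    pw e *R 1#               ∎
  arrowSum (suc n) ok L e = begin
    sumR R (map (arrowTerm (suc n) ok L e) (boolVecs (suc n)))
      ≈⟨ sum-boolVecs-suc n (arrowTerm (suc n) ok L e) ⟩
    sumR R (map (λ A → arrowTerm (suc n) ok L e (true ∷ A)) (boolVecs n)) +R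
    sumR R (map (λ A → arrowTerm (suc n) ok L e (false ∷ A)) (boolVecs n))
      ≈⟨ +-cong (sum-cong (boolVecs n) (arrowTerm-true n ok L e)) (sum-cong (boolVecs n) (reflexive ∘ arrowTerm-false n ok L e)) ⟩
    sumR R (map (λ A → if ok 0 then - arrowTerm n ok' L' (e + L 0) A else 0#) (boolVecs n)) +R
    sumR R (map (arrowTerm n ok' L' e) (boolVecs n))
      ≈⟨ +-cong (sum-if (boolVecs n) (ok 0) _) (arrowSum n ok' L' e) ⟩
    (if ok 0 then sumR R (map (λ A → - arrowTerm n ok' L' (e + L 0) A) (boolVecs n)) else 0#) +R pw e *R rest
      ≈⟨ firstRow (ok 0) ⟩
    pw e *R (rowFactor (ok 0) (L 0) *R rest) ∎
    where
    ok' : ℕ → Bool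
    ok' = ok ∘ suc
    L' : ℕ → ℕ
    L' = L ∘ suc
    rest : Carrier
    rest = arrowProduct n ok' L'
    firstRow : ∀ b → (if b then sumR R (map (λ A → - arrowTerm n ok' L' (e + L 0) A) (boolVecs n)) else 0#) +R pw e *R rest
                     ≈ pw e *R (rowFactor b (L 0) *R rest)
    firstRow false = ≈-trans (+-identityˡ _) (*-congˡ (≈-sym (*-identityˡ _)))
    firstRow true  = begin
      sumR R (map (λ A → - arrowTerm n ok' L' (e + L 0) A) (boolVecs n)) +R pw e *R rest
        ≈⟨ +-congʳ (≈-trans (sum-neg (boolVecs n) _) (-‿cong (arrowSum n ok' L' (e + L 0)))) ⟩
      - (pw (e + L 0) *R rest) +R pw e *R rest  ≈⟨ +-congʳ (-‿cong (*-congʳ (pw-+ e (L 0)))) ⟩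
      - ((pw e *R pw (L 0)) *R rest) +R pw e *R rest ≈⟨ one-minus (pw e) (pw (L 0)) rest ⟩
      pw e *R ((1# +R - pw (L 0)) *R rest)       ∎

  partitionWeight : (k : ℕ) → Vec ℕ k → Carrier
  partitionWeight k lam = pw (sizePart lam) *R arrowProduct k (arrowOK k lam) (arrowLength k lam)

  partitionSum : ℕ → Carrier
  partitionSum k =
    sumR R (map (λ lam → if isPartition lam ∧ insideDelta (k ∸ 1) lam then partitionWeight k lam else 0#) (vecsUpTo k k))

  halfConfigSum-factor : ∀ k → sumR R (map (wt R q k) (HD k)) ≈ partitionSum k
  halfConfigSum-factor k = begin
    sumR R (map (wt R q k) (HD k))
      ≈⟨ sum-filter (cartesianProduct (vecsUpTo k k) (boolVecs k)) _ (wt R q k) ⟩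
    sumR R (map (λ c → if isHalf c then wt R q k c else 0#) (cartesianProduct (vecsUpTo k k) (boolVecs k)))
      ≈⟨ sum-cart (vecsUpTo k k) (boolVecs k) _ ⟩
    sumR R (map (λ lam → sumR R (map (λ A → if isHalfConfig k lam A then wt R q k (lam , A) else 0#) (boolVecs k))) (vecsUpTo k k))
      ≈⟨ sum-cong (vecsUpTo k k) arrowsSummed ⟩
    sumR R (map (λ lam → if isPartition lam ∧ insideDelta (k ∸ 1) lam then partitionWeight k lam else 0#) (vecsUpTo k k)) ∎
    where
    isHalf : Vec ℕ k × Vec Bool k → Bool
    isHalf (lam , A) = isHalfConfig k lam A
    arrowsSummed : ∀ lam → sumR R (map (λ A → if isHalfConfig k lam A then wt R q k (lam , A) else 0#) (boolVecs k))
                           ≈ (if isPartition lam ∧ insideDelta (k ∸ 1) lam then partitionWeight k lam else 0#)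
    arrowsSummed lam = begin
      sumR R (map (λ A → if isHalfConfig k lam A then wt R q k (lam , A) else 0#) (boolVecs k))
        ≡⟨ cong (sumR R) (map-cong (λ A → if-∧ (isPartition lam) (insideDelta (k ∸ 1) lam) _ (wt R q k (lam , A)) 0#) (boolVecs k)) ⟩
      sumR R (map (λ A → if valid then arrowTerm k (arrowOK k lam) (arrowLength k lam) (sizePart lam) A else 0#) (boolVecs k))
        ≈⟨ sum-if (boolVecs k) valid _ ⟩
      (if valid then sumR R (map (arrowTerm k (arrowOK k lam) (arrowLength k lam) (sizePart lam)) (boolVecs k)) else 0#)
        ≈⟨ if-cong valid (λ _ → arrowSum k (arrowOK k lam) (arrowLength k lam) (sizePart lam)) ⟩
      (if valid then partitionWeight k lam else 0#) ∎
      where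
      valid : Bool
      valid = isPartition lam ∧ insideDelta (k ∸ 1) lam

  qProduct : ℕ → ℕ → Carrier
  qProduct p zero    = 1#
  qProduct p (suc r) = if p ≤ᵇ r then (1# +R - pw (suc r)) *R qProduct p r else 1#

  qProduct-diag : ∀ m → qProduct m m ≡ 1#
  qProduct-diag zero    = refl
  qProduct-diag (suc m) = cong (λ b → if b then (1# +R - pw (suc m)) *R qProduct (suc m) m else 1#) (<ᵇ-irrefl m)

  qProduct-lowest : ∀ m n → m < n → qProduct m n ≈ (1# +R - pw (suc m)) *R qProduct (suc m) n
  qProduct-lowest m (suc n) (s≤s m≤n) with ℕP.m≤n⇒m<n∨m≡n m≤n
  ... | inj₁ m<n rewrite ≤ᵇ-complete m≤n | <ᵇ-complete m<n = begin
    (1# +R - pw (suc n)) *R qProduct m n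
      ≈⟨ *-congˡ (qProduct-lowest m n m<n) ⟩
    (1# +R - pw (suc n)) *R ((1# +R - pw (suc m)) *R qProduct (suc m) n)
      ≈⟨ x∙yz≈y∙xz _ _ _ ⟩
    (1# +R - pw (suc m)) *R ((1# +R - pw (suc n)) *R qProduct (suc m) n) ∎
  ... | inj₂ refl rewrite ≤ᵇ-complete (ℕP.≤-refl {m}) | <ᵇ-irrefl m = *-congˡ (reflexive (qProduct-diag m))

  qTerm : ℕ → ℕ → Carrier
  qTerm n x = pw x *R qProduct x n

  qProduct-telescope : ∀ m n → m ≤ n → sumTo (suc m) (qTerm n) ≈ qProduct m n
  qProduct-telescope zero    n _   = ≈-trans (+-identityˡ _) (*-identityˡ _)
  qProduct-telescope (suc m) n m<n = begin
    sumTo (suc m) (qTerm n) +R pw (suc m) *R P′   ≈⟨ +-congʳ (qProduct-telescope m n (ℕP.<⇒≤ m<n)) ⟩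
    qProduct m n +R pw (suc m) *R P′              ≈⟨ +-congʳ (qProduct-lowest m n m<n) ⟩
    (1# +R - pw (suc m)) *R P′ +R pw (suc m) *R P′ ≈⟨ ≈-sym (distribʳ P′ _ _) ⟩
    ((1# +R - pw (suc m)) +R pw (suc m)) *R P′    ≈⟨ *-congʳ (≈-trans (+-assoc _ _ _) (≈-trans (+-congˡ (-‿inverseˡ _)) (+-identityʳ _))) ⟩
    1# *R P′                                      ≈⟨ *-identityˡ P′ ⟩
    P′                                            ∎
    where
    P′ : Carrier
    P′ = qProduct (suc m) n

  absorb : ∀ s a b P → s +R a *R P ≈ P → s +R (a *R (1# +R - b)) *R P ≈ (1# +R - (a *R b)) *R P
  absorb s a b P s+aP≈P = begin
    s +R (a *R (1# +R - b)) *R P        ≈⟨ +-congˡ (*-assoc a _ P) ⟩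
    s +R a *R ((1# +R - b) *R P)        ≈⟨ +-congˡ (≈-sym (one-minus a b P)) ⟩
    s +R (- ((a *R b) *R P) +R a *R P)  ≈⟨ +-congˡ (+-comm _ _) ⟩
    s +R (a *R P +R - ((a *R b) *R P))  ≈⟨ ≈-sym (+-assoc _ _ _) ⟩
    (s +R a *R P) +R - ((a *R b) *R P)  ≈⟨ +-congʳ s+aP≈P ⟩
    P +R - ((a *R b) *R P)              ≈⟨ +-cong (≈-sym (*-identityˡ P)) (-‿distribˡ-* (a *R b) P) ⟩
    1# *R P +R (- (a *R b)) *R P        ≈⟨ ≈-sym (distribʳ P 1# _) ⟩
    (1# +R - (a *R b)) *R P             ∎

  -- The term of a row of length x ≤ p under a row of length p, with n rows below
  -- it: q^x, the factor 1 - q^{n+1-x} if it may carry an arrow (x = p), and the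
  -- contribution P(x , n) of the rows below.
  rowTerm : ℕ → ℕ → ℕ → Carrier
  rowTerm p n x = if x ≤ᵇ p then (pw x *R rowFactor (not (x <ᵇ p)) (suc n ∸ x)) *R qProduct x n else 0#

  rowTerm-sum : ∀ p n → sumTo (suc n) (rowTerm p n) ≈ qProduct p (suc n)
  rowTerm-sum p n with p ≤ᵇ n in e
  ... | true = begin
    sumTo (suc n) (rowTerm p n)   ≈⟨ sumTo-upto (suc n) p weight ⟩
    sumTo (suc n ⊓ suc p) weight  ≡⟨ cong (λ N → sumTo N weight) (ℕP.m≥n⇒m⊓n≡n (s≤s p≤n)) ⟩
    sumTo p weight +R weight p    ≈⟨ +-cong (sumTo-cong p (λ x x<p → noArrow x (<ᵇ-complete x<p))) (reflexive lastArrow) ⟩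
    sumTo p (qTerm n) +R (pw p *R (1# +R - pw (suc n ∸ p))) *R qProduct p n
      ≈⟨ absorb _ _ _ _ (qProduct-telescope p n p≤n) ⟩
    (1# +R - (pw p *R pw (suc n ∸ p))) *R qProduct p n
      ≈⟨ *-congʳ (+-congˡ (-‿cong (≈-sym (pw-+ p (suc n ∸ p))))) ⟩
    (1# +R - pw (p + (suc n ∸ p))) *R qProduct p n
      ≡⟨ cong (λ m → (1# +R - pw m) *R qProduct p n) (ℕP.m+[n∸m]≡n (ℕP.m≤n⇒m≤1+n p≤n)) ⟩
    (1# +R - pw (suc n)) *R qProduct p n ∎
    where
    p≤n : p ≤ n
    p≤n = ≤ᵇ-sound e
    weight : ℕ → Carrier
    weight x = (pw x *R rowFactor (not (x <ᵇ p)) (suc n ∸ x)) *R qProduct x n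
    noArrow : ∀ x → (x <ᵇ p) ≡ true → weight x ≈ qTerm n x
    noArrow x x<p rewrite x<p = *-congʳ (*-identityʳ (pw x))
    lastArrow : weight p ≡ (pw p *R (1# +R - pw (suc n ∸ p))) *R qProduct p n
    lastArrow rewrite <ᵇ-irrefl p = refl
  ... | false = begin
    sumTo (suc n) (rowTerm p n) ≈⟨ sumTo-cong (suc n) (λ x x<1+n → noArrow x (ℕP.≤-<-trans (ℕP.≤-pred x<1+n) n<p)) ⟩
    sumTo (suc n) (qTerm n)     ≈⟨ qProduct-telescope n n ℕP.≤-refl ⟩
    qProduct n n                ≡⟨ qProduct-diag n ⟩
    1#                          ∎
    where
    n<p : n < p
    n<p = ℕP.≰⇒> (λ p≤n → not-¬ e (≤ᵇ-complete p≤n))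
    noArrow : ∀ x → x < p → rowTerm p n x ≈ qTerm n x
    noArrow x x<p rewrite ≤ᵇ-complete (ℕP.<⇒≤ x<p) | <ᵇ-complete x<p = *-congʳ (*-identityʳ (pw x))

  rowFits : ℕ → ℕ → ℕ → Bool
  rowFits k o x = allBelow x (λ j → inDelta (k ∸ 1) o j)

  fits : ∀ {n} → ℕ → ℕ → ℕ → Vec ℕ n → Bool
  fits k o p v = ((row v 0 ≤ᵇ p) ∧ isPartition v) ∧ insideFrom (k ∸ 1) o v

  fits-cons : ∀ k n o p x (v : Vec ℕ n) → fits k o p (x ∷ v) ≡ (rowFits k o x ∧ (x ≤ᵇ p)) ∧ fits k (suc o) x v
  fits-cons k n o p x v =
    trans (cong₂ (λ a b → ((x ≤ᵇ p) ∧ a) ∧ b) (isPartition-cons n x v) (insideFrom-cons n (k ∸ 1) o x v))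
          (∧-interchange (x ≤ᵇ p) _ (rowFits k o x) (insideFrom (k ∸ 1) (suc o) v))

  rowProduct : ∀ {n} → ℕ → ℕ → ℕ → Vec ℕ n → Carrier
  rowProduct k o p []      = 1#
  rowProduct k o p (x ∷ v) = rowFactor (arrowOKAt k o x p) (arrowLengthAt k o x) *R rowProduct k (suc o) x v

  arrowProduct-rows : ∀ k n o p (v : Vec ℕ n) (ok : ℕ → Bool) (L : ℕ → ℕ) →
    (∀ i → ok i ≡ arrowOKAt k (o + i) (row v i) (row (p ∷ v) i)) → (∀ i → L i ≡ arrowLengthAt k (o + i) (row v i)) →
    arrowProduct n ok L ≡ rowProduct k o p v
  arrowProduct-rows k zero    o p []      ok L ok≡ L≡ = refl
  arrowProduct-rows k (suc n) o p (x ∷ v) ok L ok≡ L≡ =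
    cong₂ _*R_ (cong₂ rowFactor (trans (ok≡ 0) (cong (λ r → arrowOKAt k r x p) (ℕP.+-identityʳ o)))
                                (trans (L≡ 0) (cong (λ r → arrowLengthAt k r x) (ℕP.+-identityʳ o))))
               (arrowProduct-rows k n (suc o) x v (ok ∘ suc) (L ∘ suc)
                 (λ i → trans (ok≡ (suc i)) (cong (λ r → arrowOKAt k r (row v i) (row (x ∷ v) i)) (ℕP.+-suc o i)))
                 (λ i → trans (L≡ (suc i)) (cong (λ r → arrowLengthAt k r (row v i)) (ℕP.+-suc o i))))

  fitsTerm : ∀ {n} → ℕ → ℕ → ℕ → Vec ℕ n → Carrier
  fitsTerm k o p v = if fits k o p v then pw (sizePart v) *R rowProduct k o p v else 0#

  tailSum : ℕ → ℕ → ℕ → ℕ → Carrier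
  tailSum k n o p = sumR R (map (fitsTerm k o p) (vecsUpTo n k))

  rowWeight : ℕ → ℕ → ℕ → ℕ → Carrier
  rowWeight k o p x = pw x *R rowFactor (arrowOKAt k o x p) (arrowLengthAt k o x)

  fitsTerm-cons : ∀ k n o p x (v : Vec ℕ n) → fitsTerm k o p (x ∷ v) ≈
    (if rowFits k o x ∧ (x ≤ᵇ p) then rowWeight k o p x *R fitsTerm k (suc o) x v else 0#)
  fitsTerm-cons k n o p x v =
    ≈-trans (reflexive (cong₂ (λ b s → if b then pw s *R rowProduct k o p (x ∷ v) else 0#)
                              (fits-cons k n o p x v) (sumBelow-suc n (row (x ∷ v)))))
            (split (rowFits k o x ∧ (x ≤ᵇ p)) (fits k (suc o) x v))
    where
    split : ∀ a b → (if a ∧ b then pw (x + sizePart v) *R rowProduct k o p (x ∷ v) else 0#) ≈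
                    (if a then rowWeight k o p x *R (if b then pw (sizePart v) *R rowProduct k (suc o) x v else 0#) else 0#)
    split false b     = ≈-refl
    split true  false = ≈-sym (zeroʳ _)
    split true  true  = ≈-trans (*-congʳ (pw-+ x (sizePart v))) (interchange _ _ _ _)

  -- The bound on the
  -- first row is a function pf of that row, so that the first row of the diagram,
  -- which has no row above it, can be handled with pf = id.
  peelRow : ∀ k n o (pf : ℕ → ℕ) →
    sumR R (map (λ v → fitsTerm k o (pf (row v 0)) v) (vecsUpTo (suc n) k)) ≈
    sumR R (map (λ x → if rowFits k o x ∧ (x ≤ᵇ pf x) then rowWeight k o (pf x) x *R tailSum k n (suc o) x else 0#) (upTo (suc k)))
  peelRow k n o pf =
    ≈-trans (sum-concatMap (λ x → map (x ∷_) (vecsUpTo n k)) _ (upTo (suc k))) (sum-cong (upTo (suc k)) firstRow)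
    where
    firstRow : ∀ x → sumR R (map (λ v → fitsTerm k o (pf (row v 0)) v) (map (x ∷_) (vecsUpTo n k))) ≈
                     (if rowFits k o x ∧ (x ≤ᵇ pf x) then rowWeight k o (pf x) x *R tailSum k n (suc o) x else 0#)
    firstRow x = begin
      sumR R (map (λ v → fitsTerm k o (pf (row v 0)) v) (map (x ∷_) (vecsUpTo n k)))
        ≈⟨ sum-map (x ∷_) _ (vecsUpTo n k) ⟩
      sumR R (map (λ v → fitsTerm k o (pf x) (x ∷ v)) (vecsUpTo n k))
        ≈⟨ sum-cong (vecsUpTo n k) (fitsTerm-cons k n o (pf x) x) ⟩
      sumR R (map (λ v → if fitsRow then rowWeight k o (pf x) x *R fitsTerm k (suc o) x v else 0#) (vecsUpTo n k))
        ≈⟨ sum-if (vecsUpTo n k) fitsRow _ ⟩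
      (if fitsRow then sumR R (map (λ v → rowWeight k o (pf x) x *R fitsTerm k (suc o) x v) (vecsUpTo n k)) else 0#)
        ≈⟨ if-cong fitsRow (λ _ → sum-scale (vecsUpTo n k) _ _) ⟩
      (if fitsRow then rowWeight k o (pf x) x *R tailSum k n (suc o) x else 0#) ∎
      where
      fitsRow : Bool
      fitsRow = rowFits k o x ∧ (x ≤ᵇ pf x)

  rowRecursion : ∀ k n o p → suc o + n ≡ k → tailSum k n (suc o) p ≈ qProduct p n
  rowRecursion k zero o p _ = ≈-trans (+-identityʳ _) (*-identityˡ _)
  rowRecursion .(suc o + suc n) (suc n) o p refl = begin
    tailSum k (suc n) (suc o) p                           ≈⟨ peelRow k n (suc o) (const p) ⟩
    sumR R (map term (upTo (suc k)))                      ≈⟨ sum-upTo (suc k) term ⟩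
    sumTo (suc k) term                                    ≈⟨ sumTo-cong (suc k) (λ x _ → termEval x) ⟩
    sumTo (suc k) (λ x → if x ≤ᵇ n then rowTerm p n x else 0#) ≈⟨ sumTo-upto (suc k) n (rowTerm p n) ⟩
    sumTo (suc k ⊓ suc n) (rowTerm p n)                   ≡⟨ cong (λ N → sumTo N (rowTerm p n)) (ℕP.m≥n⇒m⊓n≡n (ℕP.m≤n⇒m≤1+n (ℕP.m≤n+m (suc n) (suc o)))) ⟩
    sumTo (suc n) (rowTerm p n)                           ≈⟨ rowTerm-sum p n ⟩
    qProduct p (suc n)                                    ∎
    where
    k : ℕ
    k = suc o + suc n
    weight : ℕ → Carrier
    weight x = rowWeight k (suc o) p x *R tailSum k n (suc (suc o)) x
    term : ℕ → Carrier
    term x = if rowFits k (suc o) x ∧ (x ≤ᵇ p) then weight x else 0#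
    bounded : ∀ x → (if (x ≤ᵇ n) ∧ (x ≤ᵇ p) then weight x else 0#) ≈ (if x ≤ᵇ n then rowTerm p n x else 0#)
    bounded x with x ≤ᵇ n in e
    ... | false = ≈-refl
    ... | true  = if-cong (x ≤ᵇ p) (λ _ → *-cong (*-congˡ (reflexive (cong₂ rowFactor okEval lengthEval)))
                                                 (rowRecursion k n (suc o) x (cong suc (sym (ℕP.+-suc o n)))))
      where
      inRow : suc o + x < k
      inRow = ℕP.+-monoʳ-< (suc o) (s≤s (≤ᵇ-sound e))
      okEval : arrowOKAt k (suc o) x p ≡ not (x <ᵇ p)
      okEval = arrowOKAt-eval k (suc o) x p inRow
      lengthEval : arrowLengthAt k (suc o) x ≡ suc n ∸ x
      lengthEval = trans (arrowLengthAt-eval k (suc o) x (ℕP.<⇒≤ inRow)) (ℕP.[m+n]∸[m+o]≡n∸o (suc o) (suc n) x)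
    termEval : ∀ x → term x ≈ (if x ≤ᵇ n then rowTerm p n x else 0#)
    termEval x = ≈-trans (reflexive (cong (λ b → if b ∧ (x ≤ᵇ p) then weight x else 0#)
                                          (rowInside-eval (k ∸ 1) (suc o) n x (ℕP.+-suc o n))))
                         (bounded x)

  partitionWeight-rows : ∀ n (lam : Vec ℕ (suc n)) →
    (if isPartition lam ∧ insideDelta n lam then partitionWeight (suc n) lam else 0#) ≡ fitsTerm (suc n) 0 (row lam 0) lam
  partitionWeight-rows n lam =
    cong₂ (λ b w → if b then pw (sizePart lam) *R w else 0#)
          (cong (λ b → (b ∧ isPartition lam) ∧ insideDelta n lam) (sym (≤ᵇ-complete (ℕP.≤-refl {row lam 0}))))
          (arrowProduct-rows (suc n) (suc n) 0 (row lam 0) lam (arrowOK (suc n) lam) (arrowLength (suc n) lam) rowAbove (λ i → refl))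
    where
    -- the row above row i is row i - 1, and row 0 itself for i = 0
    rowAbove : ∀ i → arrowOK (suc n) lam i ≡ arrowOKAt (suc n) i (row lam i) (row (row lam 0 ∷ lam) i)
    rowAbove zero    = refl
    rowAbove (suc i) = refl

  -- The first row of λ ⊂ δ_n carries no arrow; if it has length x ≤ n, then
  -- together with the rows below it, it contributes q^x P(x , n).
  firstRow-eval : ∀ n x →
    (if rowFits (suc n) 0 x ∧ (x ≤ᵇ x) then rowWeight (suc n) 0 x x *R tailSum (suc n) n 1 x else 0#) ≈
    (if x ≤ᵇ n then qTerm n x else 0#)
  firstRow-eval n x =
    ≈-trans (reflexive (cong (λ b → if b then rowWeight (suc n) 0 x x *R tailSum (suc n) n 1 x else 0#) fitsEval))
            (if-cong (x ≤ᵇ n) (λ x≤n → *-cong (noArrow (≤ᵇ-sound x≤n)) (rowRecursion (suc n) n 0 x refl)))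
    where
    fitsEval : (rowFits (suc n) 0 x ∧ (x ≤ᵇ x)) ≡ (x ≤ᵇ n)
    fitsEval = trans (cong₂ _∧_ (rowInside-eval n 0 n x refl) (≤ᵇ-complete (ℕP.≤-refl {x}))) (∧-identityʳ _)
    noArrow : x ≤ n → rowWeight (suc n) 0 x x ≈ pw x
    noArrow x≤n =
      ≈-trans (*-congˡ (reflexive (cong (λ b → rowFactor b (arrowLengthAt (suc n) 0 x)) (arrowOKAt-eval (suc n) 0 x x (s≤s x≤n)))))
              (*-identityʳ (pw x))

  partitionSum-one : ∀ k → partitionSum k ≈ 1#
  partitionSum-one zero    = ≈-trans (+-identityʳ _) (*-identityˡ _)
  partitionSum-one (suc n) = begin
    partitionSum (suc n)                                          ≈⟨ sum-cong (vecsUpTo k k) (reflexive ∘ partitionWeight-rows n) ⟩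
    sumR R (map (λ v → fitsTerm k 0 (id (row v 0)) v) (vecsUpTo k k)) ≈⟨ peelRow k n 0 id ⟩
    sumR R (map term (upTo (suc k)))                              ≈⟨ sum-upTo (suc k) term ⟩
    sumTo (suc k) term                                            ≈⟨ sumTo-cong (suc k) (λ x _ → firstRow-eval n x) ⟩
    sumTo (suc k) (λ x → if x ≤ᵇ n then qTerm n x else 0#)        ≈⟨ sumTo-upto (suc k) n (qTerm n) ⟩
    sumTo (suc k ⊓ suc n) (qTerm n)                               ≡⟨ cong (λ N → sumTo N (qTerm n)) (ℕP.m≥n⇒m⊓n≡n (ℕP.n≤1+n k)) ⟩
    sumTo (suc n) (qTerm n)                                       ≈⟨ qProduct-telescope n n ℕP.≤-refl ⟩
    qProduct n n                                                  ≡⟨ qProduct-diag n ⟩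
    1#                                                            ∎
    where
    k : ℕ
    k = suc n
    term : ℕ → Carrier
    term x = if rowFits k 0 x ∧ (x ≤ᵇ x) then rowWeight k 0 x x *R tailSum k n 1 x else 0#

proposition2p2 : ∀ {c ℓ} (R : CommutativeRing c ℓ) (q : CommutativeRing.Carrier R) (k : ℕ) →
    CommutativeRing._≈_ R (sumR R (map (wt R q k) (HD k))) (CommutativeRing.1# R)
proposition2p2 R q k = ≈-trans (halfConfigSum-factor k) (partitionSum-one k)
  where
  open CommutativeRing R using () renaming (trans to ≈-trans)
  open Weights R q
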